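{- Let $q$ be a prime power and $g^{(3)}=q^3-2q+1$. For integers $r,s_1,\dots,s_{q-1},t_1,\dots,t_{q-1},u$ let $\Omega_{r,s_1,\dots,s_{q-1},t_1,\dots,t_{q-1},u}$ be the set of $(i,j_1,\dots,j_{q-1},k_1,\dots,k_{q-1})\in\mathbb{Z}^{2q-1}$ such that $-r\le i$; $-s_\mu\le i+(q^2+q)k_\mu<-s_\mu+(q^2+q)$ for $\mu=1,\dots,q-1$; $-t_\nu\le qi+(q^2+q)j_\nu-(q+1)\sum_{\mu=1}^{q-1}k_\mu<-t_\nu+(q^2+q)$ for $\nu=1,\dots,q-1$; and $-u\le -q^2i-(q^2+q)\sum_{\nu=1}^{q-1}j_\nu-(q+1)\sum_{\mu=1}^{q-1}k_\mu$. Then for all integers $s_\mu,t_\nu,u$ there exists a constant $R$ depending on $s_1,\dots,s_{q-1},t_1,\dots,t_{q-1},u$ such that for all $r\ge R$, \[\#\Omega_{r,s_1,\dots,s_{q-1},t_1,\dots,t_{q-1},u}=1-g^{(3)}+r+\sum_{\mu=1}^{q-1}s_\mu+\sum_{\nu=1}^{q-1}t_\nu+u.\]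
   Context: $q$ is a power of a prime; $g^{(3)}=q^3-2q+1$. -}

module Defs where

open import Data.Nat using (ℕ; _∸_; _≥_) renaming (_^_ to _^ℕ_)
open import Data.Nat.Primality using (Prime)
open import Data.Integer using (ℤ; +_; _+_; _-_; _*_; -_; _≤_; _<_)
open import Data.Fin using (Fin)
open import Data.Vec using (Vec; lookup; foldr)
open import Data.List using (List; length)
open import Data.List.Relation.Unary.Unique.Propositional using (Unique)
open import Data.List.Membership.Propositional using (_∈_)
open import Data.Product using (Σ; _×_; ∃; _,_)
open import Function.Bundles using (_⇔_)
open import Relation.Binary.PropositionalEquality using (_≡_)

IsPrimePower : ℕ → Set
IsPrimePower q = Σ ℕ λ p → Σ ℕ λ m → Prime p × m ≥ 1 × q ≡ p ^ℕ m

sumℤ : ∀ {n} → Vec ℤ n → ℤ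
sumℤ = foldr _ _+_ (+ 0)

g3 : ℕ → ℤ
g3 q = + q * + q * + q - + 2 * + q + + 1

HasCard : ∀ {A : Set} → (A → Set) → ℕ → Set
HasCard {A} P n = Σ (List A) λ L → Unique L × (∀ x → (x ∈ L) ⇔ P x) × length L ≡ n

Point : ℕ → Set
Point q = ℤ × Vec ℤ (q ∸ 1) × Vec ℤ (q ∸ 1)

Ω : (q : ℕ) → (r : ℤ) → (s t : Vec ℤ (q ∸ 1)) → (u : ℤ) → Point q → Set
Ω q r s t u (i , j , k) =
    (- r ≤ i)
  × (∀ μ → (- lookup s μ ≤ i + Q2 * lookup k μ)
           × (i + Q2 * lookup k μ < - lookup s μ + Q2))
  × (∀ ν → (- lookup t ν ≤ Q * i + Q2 * lookup j ν - Q1 * sumℤ k)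
           × (Q * i + Q2 * lookup j ν - Q1 * sumℤ k < - lookup t ν + Q2))
  × (- u ≤ - (Q * Q) * i - Q2 * sumℤ j - Q1 * sumℤ k)
  where
    Q Q1 Q2 : ℤ
    Q = + q
    Q1 = Q + + 1
    Q2 = Q * Q + Q

module Submission where

-- For fixed i the μ- and ν-conditions determine k and j uniquely by floor division by Q2 = q² + q,
-- and the last condition becomes f i = i + d i ≤ u + Σ s + Σ t, where d i is the sum of the
-- 2(q - 1) remainders of these divisions; so #Ω counts the i ≥ - r with f i ≤ u + Σ s + Σ t.
-- The function d is bounded and q Q2-periodic, f is a bijection of ℤ, and each remainder is
-- equidistributed over a period, so d has mean (q - 1)(Q2 - 1) = g. For such f the number of
-- i < b with f i ≥ b does not depend on b, and averaging over a period shows that it equals g;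
-- once r is large the count is therefore (u + Σ s + Σ t + r + 1) - g.

open import Defs
open import Data.Nat as ℕ using (ℕ; zero; suc; _∸_; NonZero; _≤?_; _<?_; _≟_; z≤n)
import Data.Nat.Properties as ℕ
open import Data.Product using (Σ; _×_; _,_; proj₁; proj₂)
open import Data.Empty using (⊥-elim)
open import Relation.Nullary using (Dec; yes; no)
open import Relation.Binary.PropositionalEquality

module FiniteSums where
  open import Data.Nat
  open import Data.Nat.Properties
  open import Data.Nat.Tactic.RingSolver using (solve-∀)
  open import Algebra.Properties.CommutativeSemigroup +-commutativeSemigroup using (interchange)
  open import Data.Sum using (inj₁; inj₂)
  open import Relation.Nullary using (¬_)

  ∑ : ℕ → (ℕ → ℕ) → ℕ
  ∑ zero    f = 0
  ∑ (suc n) f = ∑ n f + f n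

  syntax ∑ n (λ k → e) = ∑[ k < n ] e

  ∑-cong : ∀ n {f g : ℕ → ℕ} → (∀ k → k < n → f k ≡ g k) → ∑ n f ≡ ∑ n g
  ∑-cong zero    f≗g = refl
  ∑-cong (suc n) f≗g = cong₂ _+_ (∑-cong n (λ k k<n → f≗g k (m<n⇒m<1+n k<n))) (f≗g n ≤-refl)

  ∑-const : ∀ n c → ∑[ _ < n ] c ≡ n * c
  ∑-const zero    c = refl
  ∑-const (suc n) c = trans (cong (_+ c) (∑-const n c)) (+-comm (n * c) c)

  ∑-zero : ∀ n {f : ℕ → ℕ} → (∀ k → k < n → f k ≡ 0) → ∑ n f ≡ 0
  ∑-zero n f≗0 = trans (∑-cong n f≗0) (trans (∑-const n 0) (*-zeroʳ n))

  ∑-distrib-+ : ∀ n (f g : ℕ → ℕ) → ∑[ k < n ] (f k + g k) ≡ ∑ n f + ∑ n g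
  ∑-distrib-+ zero    f g = refl
  ∑-distrib-+ (suc n) f g = trans (cong (_+ (f n + g n)) (∑-distrib-+ n f g)) (interchange (∑ n f) (∑ n g) (f n) (g n))

  ∑-comm : ∀ m n (f : ℕ → ℕ → ℕ) → ∑[ a < m ] ∑[ b < n ] f a b ≡ ∑[ b < n ] ∑[ a < m ] f a b
  ∑-comm zero    n f = sym (∑-zero n (λ _ _ → refl))
  ∑-comm (suc m) n f =
    trans (cong (_+ ∑[ b < n ] f m b) (∑-comm m n f)) (sym (∑-distrib-+ n (λ b → ∑[ a < m ] f a b) (f m)))

  ∑-suc : ∀ n (f : ℕ → ℕ) → ∑ (suc n) f ≡ f 0 + ∑[ k < n ] f (suc k)
  ∑-suc zero    f = +-comm 0 (f 0)
  ∑-suc (suc n) f = trans (cong (_+ f (suc n)) (∑-suc n f)) (+-assoc (f 0) _ (f (suc n)))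

  ∑-+ : ∀ m n (f : ℕ → ℕ) → ∑ (m + n) f ≡ ∑ m f + ∑[ k < n ] f (m + k)
  ∑-+ m zero    f rewrite +-identityʳ m = sym (+-identityʳ (∑ m f))
  ∑-+ m (suc n) f rewrite +-suc m n | ∑-+ m n f = +-assoc (∑ m f) _ (f (m + n))

  ∑-* : ∀ m n (f : ℕ → ℕ) → ∑ (m * n) f ≡ ∑[ b < m ] ∑[ j < n ] f (b * n + j)
  ∑-* zero    n f = refl
  ∑-* (suc m) n f = begin
    ∑ (n + m * n) f                                        ≡⟨ cong (λ l → ∑ l f) (+-comm n (m * n)) ⟩
    ∑ (m * n + n) f                                        ≡⟨ ∑-+ (m * n) n f ⟩
    ∑ (m * n) f + ∑[ j < n ] f (m * n + j)                 ≡⟨ cong (_+ ∑[ j < n ] f (m * n + j)) (∑-* m n f) ⟩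
    ∑[ b < m ] ∑[ j < n ] f (b * n + j) + ∑[ j < n ] f (m * n + j) ∎
    where open ≡-Reasoning

  ∑-reverse : ∀ n (f : ℕ → ℕ) → ∑ n f ≡ ∑[ k < n ] f (n ∸ suc k)
  ∑-reverse zero    f = refl
  ∑-reverse (suc n) f = begin
    ∑ n f + f n                          ≡⟨ +-comm (∑ n f) (f n) ⟩
    f n + ∑ n f                          ≡⟨ cong (f n +_) (∑-reverse n f) ⟩
    f n + ∑[ k < n ] f (n ∸ suc k)       ≡⟨ ∑-suc n (λ k → f (suc n ∸ suc k)) ⟨
    ∑[ k < suc n ] f (suc n ∸ suc k)     ∎
    where open ≡-Reasoning

  𝟙 : ∀ {a} {A : Set a} → Dec A → ℕ
  𝟙 (yes _) = 1
  𝟙 (no _)  = 0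

  module _ {P : ℕ → Set} (P? : ∀ c → Dec (P c)) where

    ∑𝟙-none : ∀ n → (∀ c → c < n → ¬ P c) → ∑[ c < n ] 𝟙 (P? c) ≡ 0
    ∑𝟙-none n ¬P = ∑-zero n 𝟙≡0
      where
        𝟙≡0 : ∀ c → c < n → 𝟙 (P? c) ≡ 0
        𝟙≡0 c c<n with P? c
        ... | yes Pc = ⊥-elim (¬P c c<n Pc)
        ... | no  _  = refl

    ∑𝟙-unique : ∀ n c₀ → c₀ < n → P c₀ → (∀ c → P c → c ≡ c₀) → ∑[ c < n ] 𝟙 (P? c) ≡ 1
    ∑𝟙-unique (suc n) c₀ c₀<1+n Pc₀ unique with m≤n⇒m<n∨m≡n (≤-pred c₀<1+n) | P? n
    ... | inj₁ c₀<n  | yes Pn  = ⊥-elim (<-irrefl (sym (unique n Pn)) c₀<n)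
    ... | inj₁ c₀<n  | no  _   = trans (+-identityʳ _) (∑𝟙-unique n c₀ c₀<n Pc₀ unique)
    ... | inj₂ refl  | yes _   = cong (_+ 1) (∑𝟙-none n (λ c c<n Pc → <-irrefl (unique c Pc) c<n))
    ... | inj₂ refl  | no  ¬Pn = ⊥-elim (¬Pn Pc₀)

  ∑𝟙-< : ∀ n x → x ≤ n → ∑[ c < n ] 𝟙 (c <? x) ≡ x
  ∑𝟙-< n x x≤n = trans (∑𝟙-<-⊓ n) (m≥n⇒m⊓n≡n x≤n)
    where
      ∑𝟙-<-⊓ : ∀ n → ∑[ c < n ] 𝟙 (c <? x) ≡ n ⊓ x
      ∑𝟙-<-⊓ zero = refl
      ∑𝟙-<-⊓ (suc n) with n <? x
      ... | yes n<x = begin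
        ∑[ c < n ] 𝟙 (c <? x) + 1 ≡⟨ cong (_+ 1) (trans (∑𝟙-<-⊓ n) (m≤n⇒m⊓n≡m (<⇒≤ n<x))) ⟩
        n + 1                      ≡⟨ +-comm n 1 ⟩
        suc n                      ≡⟨ m≤n⇒m⊓n≡m n<x ⟨
        suc n ⊓ x                  ∎
        where open ≡-Reasoning
      ... | no n≮x = begin
        ∑[ c < n ] 𝟙 (c <? x) + 0 ≡⟨ +-identityʳ _ ⟩
        ∑[ c < n ] 𝟙 (c <? x)     ≡⟨ ∑𝟙-<-⊓ n ⟩
        n ⊓ x                      ≡⟨ m≥n⇒m⊓n≡n (≮⇒≥ n≮x) ⟩
        x                          ≡⟨ m≥n⇒m⊓n≡n (m≤n⇒m≤1+n (≮⇒≥ n≮x)) ⟨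
        suc n ⊓ x                  ∎
        where open ≡-Reasoning

  𝟙-≤+𝟙-> : ∀ x c → 𝟙 (x ≤? c) + 𝟙 (c <? x) ≡ 1
  𝟙-≤+𝟙-> x c with x ≤? c | c <? x
  ... | yes x≤c | yes c<x = ⊥-elim (<⇒≱ c<x x≤c)
  ... | yes _   | no  _   = refl
  ... | no  _   | yes _   = refl
  ... | no  x≰c | no  c≮x = ⊥-elim (x≰c (≮⇒≥ c≮x))

  𝟙-≤≡𝟙-<+𝟙-≡ : ∀ c x → 𝟙 (c ≤? x) ≡ 𝟙 (c <? x) + 𝟙 (x ≟ c)
  𝟙-≤≡𝟙-<+𝟙-≡ c x with c ≤? x | c <? x | x ≟ c
  ... | yes _   | yes c<x | yes x≡c = ⊥-elim (<-irrefl (sym x≡c) c<x)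
  ... | yes _   | yes _   | no  _   = refl
  ... | yes _   | no  _   | yes _   = refl
  ... | yes c≤x | no  c≮x | no  x≢c = ⊥-elim (x≢c (≤-antisym (≮⇒≥ c≮x) c≤x))
  ... | no  c≰x | yes c<x | _       = ⊥-elim (c≰x (<⇒≤ c<x))
  ... | no  c≰x | no  _   | yes x≡c = ⊥-elim (c≰x (≤-reflexive (sym x≡c)))
  ... | no  _   | no  _   | no  _   = refl

  gauss : ∀ m → 2 * ∑[ k < suc m ] k ≡ suc m * m
  gauss zero    = refl
  gauss (suc m) = begin
    2 * (∑[ k < suc m ] k + suc m)     ≡⟨ *-distribˡ-+ 2 (∑[ k < suc m ] k) (suc m) ⟩
    2 * ∑[ k < suc m ] k + 2 * suc m   ≡⟨ cong (_+ 2 * suc m) (gauss m) ⟩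
    suc m * m + 2 * suc m              ≡⟨ solve₁ m ⟩
    suc (suc m) * suc m                ∎
    where
      open ≡-Reasoning
      solve₁ : ∀ m → suc m * m + 2 * suc m ≡ suc (suc m) * suc m
      solve₁ = solve-∀

open FiniteSums

module Cardinality where
  open import Data.Nat using (_<_; _+_)
  open import Data.Nat.Properties using (+-comm; +-identityʳ)
  open import Data.List using (length; map; filter; downFrom)
  open import Data.List.Properties using (length-map)
  open import Data.List.Membership.Propositional using (_∈_)
  open import Data.List.Membership.Propositional.Properties using (∈-map⁺; ∈-map⁻; ∈-filter⁺; ∈-filter⁻; ∈-downFrom⁺; ∈-downFrom⁻)
  import Data.List.Relation.Unary.Unique.Propositional.Properties as Unique
  open import Function.Bundles using (mk⇔; module Equivalence)
  open import Function.Definitions using (Injective)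

  length-filter-downFrom : ∀ {P : ℕ → Set} (P? : ∀ c → Dec (P c)) n →
    length (filter P? (downFrom n)) ≡ ∑[ c < n ] 𝟙 (P? c)
  length-filter-downFrom P? zero = refl
  length-filter-downFrom P? (suc n) with P? n
  ... | yes _ = trans (cong suc (length-filter-downFrom P? n)) (+-comm 1 _)
  ... | no  _ = trans (length-filter-downFrom P? n) (sym (+-identityʳ _))

  hasCard-∑𝟙 : ∀ {P : ℕ → Set} (P? : ∀ c → Dec (P c)) n →
    HasCard (λ c → c < n × P c) (∑[ c < n ] 𝟙 (P? c))
  hasCard-∑𝟙 P? n =
    filter P? (downFrom n) ,
    Unique.filter⁺ P? (Unique.downFrom⁺ n) ,
    (λ c → mk⇔ (λ c∈ → let c∈↓ , Pc = ∈-filter⁻ P? c∈ in ∈-downFrom⁻ c∈↓ , Pc)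
               (λ (c<n , Pc) → ∈-filter⁺ P? (∈-downFrom⁺ c<n) Pc)) ,
    length-filter-downFrom P? n

  hasCard-image : ∀ {A B : Set} {P : A → Set} {Q : B → Set} {n} (f : A → B) → Injective _≡_ _≡_ f →
    (∀ x → P x → Q (f x)) → (∀ y → Q y → Σ A λ x → P x × y ≡ f x) →
    HasCard P n → HasCard Q n
  hasCard-image {Q = Q} f f-inj P⇒Q Q⇒P (xs , unique , xs≐P , |xs|≡n) =
    map f xs , Unique.map⁺ f-inj unique , (λ y → mk⇔ (to y) (from y)) , trans (length-map f xs) |xs|≡n
    where
      to : ∀ y → y ∈ map f xs → Q y
      to y y∈ with ∈-map⁻ f y∈
      ... | x , x∈ , refl = P⇒Q x (Equivalence.to (xs≐P x) x∈)
      from : ∀ y → Q y → y ∈ map f xs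
      from y Qy with Q⇒P y Qy
      ... | x , Px , refl = ∈-map⁺ f (Equivalence.from (xs≐P x) Px)

open Cardinality

open import Data.Integer as ℤ using (ℤ; +_; -[1+_]; _+_; _-_; _*_; -_; _≤_; _<_; 0ℤ; 1ℤ; -1ℤ; ∣_∣; +≤+; _/ℕ_; _%ℕ_)
open import Data.Integer.Properties
  using (+-comm; +-identityˡ; +-identityʳ; +-inverseˡ; +-inverseʳ; *-comm; *-zeroˡ; *-identityʳ; neg-involutive; neg-distrib-+
        ; +-injective; pos-+; pos-*; ⊖-≥; m-n≡m⊖n; 0≤i⇒+∣i∣≡i; i≡j⇒i-j≡0
        ; ≤-trans; ≤-antisym; ≰⇒>; i≤i+j; i≤j⇒0≤j-i; 0≤i-j⇒j≤i; i<j⇒suc[i]≤j; suc[i]≤j⇒i<j; drop‿+≤+; *-monoʳ-≤-nonNeg)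
open import Data.Integer.DivMod using (a≡a%ℕn+[a/ℕn]*n; n%ℕd<d)
open import Data.Integer.Tactic.RingSolver using (solve-∀)
open import Data.Nat.Tactic.RingSolver using () renaming (solve-∀ to ℕ-solve-∀)
open import Data.Nat.DivMod using (m<n⇒m%n≡m)
open import Data.Nat.Primality using (prime⇒nonZero)
open import Data.Vec using (Vec; []; _∷_; map; sum; lookup)
open import Data.Vec.Properties using (lookup-map; tabulate∘lookup; tabulate-cong)
open import Algebra.Properties.CommutativeSemigroup ℕ.+-commutativeSemigroup using (xy∙z≈xz∙y; xy∙z≈x∙zy)

module _ {A : Set} (F : ℤ → A) (step : ∀ w → F (w + 1ℤ) ≡ F w) where

  step⇒shift-invariant : ∀ w n → F (w + + n) ≡ F w
  step⇒shift-invariant w zero    = cong F (+-identityʳ w)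
  step⇒shift-invariant w (suc n) = trans (cong F (reassoc w (+ n))) (trans (step (w + + n)) (step⇒shift-invariant w n))
    where
      reassoc : ∀ w n → w + (1ℤ + n) ≡ w + n + 1ℤ
      reassoc = solve-∀

  step⇒constant : ∀ w → F w ≡ F 0ℤ
  step⇒constant (+ n)    = step⇒shift-invariant 0ℤ n
  step⇒constant -[1+ n ] = sym (trans (cong F (sym (+-inverseˡ (+ suc n)))) (step⇒shift-invariant -[1+ n ] (suc n)))

module _ (n : ℕ) (φ : ℤ → ℕ) (periodic : ∀ x → φ (x + + n) ≡ φ x) where

  ∑-periodic-shift : ∀ w → ∑[ k < n ] φ (w + + k) ≡ ∑[ k < n ] φ (+ k)
  ∑-periodic-shift w = trans (step⇒constant S S-step w) (∑-cong n (λ k _ → cong φ (+-identityˡ (+ k))))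
    where
      S : ℤ → ℕ
      S w = ∑[ k < n ] φ (w + + k)
      S-step : ∀ w → S (w + 1ℤ) ≡ S w
      S-step w = ℕ.+-cancelʳ-≡ (φ w) (S (w + 1ℤ)) (S w) (begin
        S (w + 1ℤ) ℕ.+ φ w                        ≡⟨ ℕ.+-comm (S (w + 1ℤ)) (φ w) ⟩
        φ w ℕ.+ S (w + 1ℤ)                        ≡⟨ cong₂ ℕ._+_ (cong φ (sym (+-identityʳ w))) (∑-cong n (λ k _ → cong φ (reassoc w (+ k)))) ⟩
        φ (w + + 0) ℕ.+ ∑[ k < n ] φ (w + + suc k) ≡⟨ ∑-suc n (λ k → φ (w + + k)) ⟨
        S w ℕ.+ φ (w + + n)                       ≡⟨ cong (S w ℕ.+_) (periodic w) ⟩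
        S w ℕ.+ φ w                               ∎)
        where
          open ≡-Reasoning
          reassoc : ∀ w k → w + 1ℤ + k ≡ w + (1ℤ + k)
          reassoc = solve-∀

  ∑-periodic-* : ∀ m → ∑[ k < m ℕ.* n ] φ (+ k) ≡ m ℕ.* ∑[ k < n ] φ (+ k)
  ∑-periodic-* zero    = refl
  ∑-periodic-* (suc m) = begin
    ∑[ k < n ℕ.+ m ℕ.* n ] φ (+ k)                         ≡⟨ ∑-+ n (m ℕ.* n) (λ k → φ (+ k)) ⟩
    ∑[ k < n ] φ (+ k) ℕ.+ ∑[ k < m ℕ.* n ] φ (+ (n ℕ.+ k)) ≡⟨ cong (∑[ k < n ] φ (+ k) ℕ.+_) (∑-cong (m ℕ.* n) (λ k _ → shift k)) ⟩
    ∑[ k < n ] φ (+ k) ℕ.+ ∑[ k < m ℕ.* n ] φ (+ k)         ≡⟨ cong (∑[ k < n ] φ (+ k) ℕ.+_) (∑-periodic-* m) ⟩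
    ∑[ k < n ] φ (+ k) ℕ.+ m ℕ.* ∑[ k < n ] φ (+ k)         ∎
    where
      open ≡-Reasoning
      shift : ∀ k → φ (+ (n ℕ.+ k)) ≡ φ (+ k)
      shift k = trans (cong φ (trans (pos-+ n k) (+-comm (+ n) (+ k)))) (periodic (+ k))

≤-by-diff : ∀ {a b} c → 0ℤ ≤ c → c ≡ b - a → a ≤ b
≤-by-diff c 0≤c c≡b-a = 0≤i-j⇒j≤i (subst (0ℤ ≤_) c≡b-a 0≤c)

module Counting
  (d : ℤ → ℕ) (D P g : ℕ) .{{_ : NonZero P}}
  (bounded  : ∀ i → d i ℕ.≤ D)
  (periodic : ∀ i → d (i + + P) ≡ d i)
  (surjective : ∀ b → Σ ℤ λ i → i + + d i ≡ b)
  (injective  : ∀ i i′ → i + + d i ≡ i′ + + d i′ → i ≡ i′)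
  (average  : ∑[ k < P ] d (+ k) ≡ P ℕ.* g)
  where

  -- crossings b counts the i < b with i + d i ≥ b; they lie in [b - D, b), indexed by c = b - 1 - i.
  crossings : ℤ → ℕ
  crossings b = ∑[ c < D ] 𝟙 (c <? d (b - + suc c))

  unique-preimage : ∀ b → ∑[ c < suc D ] 𝟙 (d (b - + c) ≟ c) ≡ 1
  unique-preimage b = ∑𝟙-unique (λ c → d (b - + c) ≟ c) (suc D) (d i) (ℕ.s≤s (bounded i)) (cong d b-di≡i) unique
    where
      i = proj₁ (surjective b)
      b-di≡i : b - + d i ≡ i
      b-di≡i = trans (cong (_- + d i) (sym (proj₂ (surjective b)))) (cancel i (+ d i))
        where cancel : ∀ a b → a + b - b ≡ a
              cancel = solve-∀
      unique : ∀ c → d (b - + c) ≡ c → c ≡ d i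
      unique c dc≡c = +-injective (begin
        + c                  ≡⟨ solve₁ b (+ c) ⟩
        b - (b - + c)        ≡⟨ cong (λ x → b - x) b-c≡i ⟩
        b - i                ≡⟨ cong (_- i) (sym (proj₂ (surjective b))) ⟩
        i + + d i - i        ≡⟨ solve₃ i (+ d i) ⟩
        + d i                ∎)
        where
          open ≡-Reasoning
          solve₁ : ∀ b c → c ≡ b - (b - c)
          solve₁ = solve-∀
          solve₃ : ∀ i x → i + x - i ≡ x
          solve₃ = solve-∀
          b-c≡i : b - + c ≡ i
          b-c≡i = injective (b - + c) i (trans (cong (λ x → b - + c + + x) dc≡c) (trans (solve₂ b (+ c)) (sym (proj₂ (surjective b)))))
            where solve₂ : ∀ b c → b - c + c ≡ b
                  solve₂ = solve-∀

  crossings-suc : ∀ b → crossings (b + 1ℤ) ≡ crossings b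
  crossings-suc b = ℕ.+-cancelʳ-≡ z (crossings (b + 1ℤ)) (crossings b) (trans upper (sym lower))
    where
      open ≡-Reasoning
      e : ℕ → ℕ
      e c = d (b - + c)
      z = 𝟙 (e 0 ≟ 0)
      X = ∑[ c < D ] 𝟙 (suc c <? e (suc c))
      Y = ∑[ c < D ] 𝟙 (e (suc c) ≟ suc c)
      last : 𝟙 (D <? e D) ≡ 0
      last with D <? e D
      ... | yes D<eD = ⊥-elim (ℕ.<⇒≱ D<eD (bounded _))
      ... | no  _    = refl
      shifted : crossings (b + 1ℤ) ≡ 𝟙 (0 <? e 0) ℕ.+ X
      shifted = begin
        crossings (b + 1ℤ)                       ≡⟨ ∑-cong D (λ c _ → cong (λ i → 𝟙 (c <? d i)) (reassoc b (+ c))) ⟩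
        ∑[ c < D ] 𝟙 (c <? e c)                  ≡⟨ ℕ.+-identityʳ _ ⟨
        ∑[ c < D ] 𝟙 (c <? e c) ℕ.+ 0            ≡⟨ cong (∑[ c < D ] 𝟙 (c <? e c) ℕ.+_) last ⟨
        ∑[ c < suc D ] 𝟙 (c <? e c)              ≡⟨ ∑-suc D (λ c → 𝟙 (c <? e c)) ⟩
        𝟙 (0 <? e 0) ℕ.+ X                       ∎
        where reassoc : ∀ b c → b + 1ℤ - (1ℤ + c) ≡ b - c
              reassoc = solve-∀
      upper : crossings (b + 1ℤ) ℕ.+ z ≡ 1 ℕ.+ X
      upper = begin
        crossings (b + 1ℤ) ℕ.+ z          ≡⟨ cong (ℕ._+ z) shifted ⟩
        𝟙 (0 <? e 0) ℕ.+ X ℕ.+ z          ≡⟨ xy∙z≈xz∙y _ X z ⟩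
        (𝟙 (0 <? e 0) ℕ.+ z) ℕ.+ X        ≡⟨ cong (ℕ._+ X) (sym (𝟙-≤≡𝟙-<+𝟙-≡ 0 (e 0))) ⟩
        1 ℕ.+ X                           ∎
      lower : crossings b ℕ.+ z ≡ 1 ℕ.+ X
      lower = begin
        crossings b ℕ.+ z            ≡⟨ cong (ℕ._+ z) (trans (∑-cong D (λ c _ → 𝟙-≤≡𝟙-<+𝟙-≡ (suc c) (e (suc c)))) (∑-distrib-+ D _ _)) ⟩
        X ℕ.+ Y ℕ.+ z                ≡⟨ xy∙z≈x∙zy X Y z ⟩
        X ℕ.+ (z ℕ.+ Y)              ≡⟨ cong (X ℕ.+_) (trans (sym (∑-suc D (λ c → 𝟙 (e c ≟ c)))) (unique-preimage b)) ⟩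
        X ℕ.+ 1                      ≡⟨ ℕ.+-comm X 1 ⟩
        1 ℕ.+ X                      ∎

  crossings-constant : ∀ b → crossings b ≡ crossings 0ℤ
  crossings-constant = step⇒constant crossings crossings-suc

  ∑-crossings : ∑[ k < P ] crossings (+ k) ≡ ∑[ k < P ] d (+ k)
  ∑-crossings = begin
    ∑[ k < P ] ∑[ c < D ] 𝟙 (c <? d (+ k - + suc c))  ≡⟨ ∑-comm P D _ ⟩
    ∑[ c < D ] ∑[ k < P ] 𝟙 (c <? d (+ k - + suc c))  ≡⟨ ∑-cong D (λ c _ → unshift c) ⟩
    ∑[ c < D ] ∑[ k < P ] 𝟙 (c <? d (+ k))            ≡⟨ ∑-comm D P _ ⟩
    ∑[ k < P ] ∑[ c < D ] 𝟙 (c <? d (+ k))            ≡⟨ ∑-cong P (λ k _ → ∑𝟙-< D (d (+ k)) (bounded _)) ⟩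
    ∑[ k < P ] d (+ k)                                ∎
    where
      open ≡-Reasoning
      unshift : ∀ c → ∑[ k < P ] 𝟙 (c <? d (+ k - + suc c)) ≡ ∑[ k < P ] 𝟙 (c <? d (+ k))
      unshift c = trans (∑-cong P (λ k _ → cong (λ i → 𝟙 (c <? d i)) (+-comm (+ k) (- + suc c))))
                        (∑-periodic-shift P (λ i → 𝟙 (c <? d i)) (λ i → cong (λ x → 𝟙 (c <? x)) (periodic i)) (- + suc c))

  crossings≡g : ∀ b → crossings b ≡ g
  crossings≡g b = trans (crossings-constant b) (ℕ.*-cancelˡ-≡ (crossings 0ℤ) g P (begin
    P ℕ.* crossings 0ℤ                ≡⟨ ∑-const P (crossings 0ℤ) ⟨
    ∑[ k < P ] crossings 0ℤ            ≡⟨ ∑-cong P (λ k _ → sym (crossings-constant (+ k))) ⟩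
    ∑[ k < P ] crossings (+ k)         ≡⟨ ∑-crossings ⟩
    ∑[ k < P ] d (+ k)                 ≡⟨ average ⟩
    P ℕ.* g                            ∎))
    where open ≡-Reasoning

  -- For c < L, either d (b - c) ≤ c or b - c crosses b + 1, and there are g such crossings.
  window-count : ∀ b L → D ℕ.≤ L → ∑[ c < L ] 𝟙 (d (b - + c) ≤? c) ℕ.+ g ≡ L
  window-count b L D≤L = begin
    ∑[ c < L ] 𝟙 (d (b - + c) ≤? c) ℕ.+ g                                   ≡⟨ cong (∑[ c < L ] 𝟙 (d (b - + c) ≤? c) ℕ.+_) g≡crossing-count ⟩
    ∑[ c < L ] 𝟙 (d (b - + c) ≤? c) ℕ.+ ∑[ c < L ] 𝟙 (c <? d (b - + c))    ≡⟨ ∑-distrib-+ L _ _ ⟨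
    ∑[ c < L ] (𝟙 (d (b - + c) ≤? c) ℕ.+ 𝟙 (c <? d (b - + c)))             ≡⟨ ∑-cong L (λ c _ → 𝟙-≤+𝟙-> (d (b - + c)) c) ⟩
    ∑[ c < L ] 1                                                            ≡⟨ trans (∑-const L 1) (ℕ.*-identityʳ L) ⟩
    L                                                                       ∎
    where
      open ≡-Reasoning
      beyond-D : ∀ k → 𝟙 (D ℕ.+ k <? d (b - + (D ℕ.+ k))) ≡ 0
      beyond-D k with D ℕ.+ k <? d (b - + (D ℕ.+ k))
      ... | yes D+k<d = ⊥-elim (ℕ.<⇒≱ D+k<d (ℕ.≤-trans (bounded _) (ℕ.m≤m+n D k)))
      ... | no  _     = refl
      g≡crossing-count : g ≡ ∑[ c < L ] 𝟙 (c <? d (b - + c))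
      g≡crossing-count = begin
        g                                                ≡⟨ crossings≡g (b + 1ℤ) ⟨
        crossings (b + 1ℤ)                               ≡⟨ ∑-cong D (λ c _ → cong (λ i → 𝟙 (c <? d i)) (reassoc b (+ c))) ⟩
        ∑[ c < D ] 𝟙 (c <? d (b - + c))                  ≡⟨ ℕ.+-identityʳ _ ⟨
        ∑[ c < D ] 𝟙 (c <? d (b - + c)) ℕ.+ 0            ≡⟨ cong (∑[ c < D ] 𝟙 (c <? d (b - + c)) ℕ.+_) (∑-zero (L ℕ.∸ D) (λ k _ → beyond-D k)) ⟨
        ∑[ c < D ] 𝟙 (c <? d (b - + c)) ℕ.+ ∑[ k < L ℕ.∸ D ] 𝟙 (D ℕ.+ k <? d (b - + (D ℕ.+ k)))
                                                         ≡⟨ ∑-+ D (L ℕ.∸ D) (λ c → 𝟙 (c <? d (b - + c))) ⟨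
        ∑[ c < D ℕ.+ (L ℕ.∸ D) ] 𝟙 (c <? d (b - + c))   ≡⟨ cong (λ n → ∑[ c < n ] 𝟙 (c <? d (b - + c))) (ℕ.m+[n∸m]≡n D≤L) ⟩
        ∑[ c < L ] 𝟙 (c <? d (b - + c))                  ∎
        where reassoc : ∀ b c → b + 1ℤ - (1ℤ + c) ≡ b - c
              reassoc = solve-∀

  module _ (a b : ℤ) (L : ℕ) (+L≡b+1-a : + L ≡ b + 1ℤ - a) where

    index⇒point : ∀ c → c ℕ.< L × d (b - + c) ℕ.≤ c → a ≤ b - + c × b - + c + + d (b - + c) ≤ b
    index⇒point c (c<L , dc≤c) =
      ≤-by-diff (+ L - + suc c) (i≤j⇒0≤j-i (+≤+ c<L)) (trans (cong (_- + suc c) +L≡b+1-a) (solve₁ a b (+ c))) ,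
      ≤-by-diff (+ c - + d (b - + c)) (i≤j⇒0≤j-i (+≤+ dc≤c)) (solve₂ b (+ c) (+ d (b - + c)))
      where solve₁ : ∀ a b c → b + 1ℤ - a - (1ℤ + c) ≡ b - c - a
            solve₁ = solve-∀
            solve₂ : ∀ b c x → c - x ≡ b - (b - c + x)
            solve₂ = solve-∀

    point⇒index : ∀ i → a ≤ i × i + + d i ≤ b → Σ ℕ λ c → (c ℕ.< L × d (b - + c) ℕ.≤ c) × i ≡ b - + c
    point⇒index i (a≤i , fi≤b) = c , (c<L , subst (λ j → d j ℕ.≤ c) i≡b-c di≤c) , i≡b-c
      where
        c = ∣ b - i ∣
        +c≡b-i : + c ≡ b - i
        +c≡b-i = 0≤i⇒+∣i∣≡i (i≤j⇒0≤j-i (≤-trans (i≤i+j i (+ d i)) fi≤b))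
        i≡b-c : i ≡ b - + c
        i≡b-c = trans (solve₁ b i) (cong (λ x → b - x) (sym +c≡b-i))
          where solve₁ : ∀ b i → i ≡ b - (b - i)
                solve₁ = solve-∀
        c<L : c ℕ.< L
        c<L = drop‿+≤+ (≤-by-diff (i - a) (i≤j⇒0≤j-i a≤i)
                (trans (solve₂ a b i) (cong₂ (λ l x → l - (1ℤ + x)) (sym +L≡b+1-a) (sym +c≡b-i))))
          where solve₂ : ∀ a b i → i - a ≡ b + 1ℤ - a - (1ℤ + (b - i))
                solve₂ = solve-∀
        di≤c : d i ℕ.≤ c
        di≤c = drop‿+≤+ (≤-by-diff (b - (i + + d i)) (i≤j⇒0≤j-i fi≤b)
                 (trans (solve₃ b i (+ d i)) (cong (_- + d i) (sym +c≡b-i))))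
          where solve₃ : ∀ b i x → b - (i + x) ≡ b - i - x
                solve₃ = solve-∀

  window : ∀ a b → + D ≤ b + 1ℤ - a →
    Σ ℕ λ N → HasCard (λ i → a ≤ i × i + + d i ≤ b) N × + N + + g ≡ b + 1ℤ - a
  window a b D≤b+1-a =
    N , hasCard-image (λ c → b - + c) minus-injective (index⇒point a b L +L≡b+1-a) (point⇒index a b L +L≡b+1-a) (hasCard-∑𝟙 _ L) ,
    trans (sym (pos-+ N g)) (trans (cong +_ (window-count b L D≤L)) +L≡b+1-a)
    where
      L = ∣ b + 1ℤ - a ∣
      +L≡b+1-a : + L ≡ b + 1ℤ - a
      +L≡b+1-a = 0≤i⇒+∣i∣≡i (≤-trans (+≤+ z≤n) D≤b+1-a)
      D≤L : D ℕ.≤ L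
      D≤L = drop‿+≤+ (subst (+ D ≤_) (sym +L≡b+1-a) D≤b+1-a)
      N = ∑[ c < L ] 𝟙 (d (b - + c) ≤? c)
      minus-injective : ∀ {c c′} → b - + c ≡ b - + c′ → c ≡ c′
      minus-injective {c} {c′} eq = +-injective (trans (solve₁ b (+ c)) (trans (cong (λ x → b - x) eq) (sym (solve₁ b (+ c′)))))
        where solve₁ : ∀ b c → c ≡ b - (b - c)
              solve₁ = solve-∀

module _ (n : ℕ) .{{_ : NonZero n}} where

  quotient-≤ : ∀ k k′ r r′ → r′ ℕ.< n → + r + k * + n ≡ + r′ + k′ * + n → k ≤ k′
  quotient-≤ k k′ r r′ r′<n eq with k ℤ.≤? k′
  ... | yes k≤k′ = k≤k′
  ... | no  k≰k′ = ⊥-elim (ℕ.<⇒≱ r′<n (ℕ.≤-trans (ℕ.m≤n+m n r) (drop‿+≤+ r+n≤r′)))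
    where
      0≤k-k′-1 : 0ℤ ≤ k - k′ - 1ℤ
      0≤k-k′-1 = ≤-by-diff _ (i≤j⇒0≤j-i (i<j⇒suc[i]≤j (≰⇒> k≰k′))) (solve₁ k k′)
        where solve₁ : ∀ k k′ → k - (1ℤ + k′) ≡ k - k′ - 1ℤ - 0ℤ
              solve₁ = solve-∀
      r+n≤r′ : + r + + n ≤ + r′
      r+n≤r′ = ≤-by-diff _ (*-monoʳ-≤-nonNeg (+ n) 0≤k-k′-1) (begin
        (k - k′ - 1ℤ) * + n                       ≡⟨ solve₂ (+ r) (+ n) k k′ ⟩
        + r + k * + n - k′ * + n - (+ r + + n)    ≡⟨ cong (λ x → x - k′ * + n - (+ r + + n)) eq ⟩
        + r′ + k′ * + n - k′ * + n - (+ r + + n)  ≡⟨ solve₃ (+ r′) (k′ * + n) (+ r + + n) ⟩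
        + r′ - (+ r + + n)                        ∎)
        where
          open ≡-Reasoning
          solve₂ : ∀ r n k k′ → (k - k′ - 1ℤ) * n ≡ r + k * n - k′ * n - (r + n)
          solve₂ = solve-∀
          solve₃ : ∀ r x y → r + x - x - y ≡ r - y
          solve₃ = solve-∀

  /ℕ-unique : ∀ a k r → r ℕ.< n → a ≡ + r + k * + n → a /ℕ n ≡ k
  /ℕ-unique a k r r<n a≡r+kn = ≤-antisym
    (quotient-≤ (a /ℕ n) k (a %ℕ n) r r<n (trans (sym (a≡a%ℕn+[a/ℕn]*n a n)) a≡r+kn))
    (quotient-≤ k (a /ℕ n) r (a %ℕ n) (n%ℕd<d a n) (trans (sym a≡r+kn) (a≡a%ℕn+[a/ℕn]*n a n)))

  %ℕ≡-/ℕ : ∀ a → + (a %ℕ n) ≡ a - + n * (a /ℕ n)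
  %ℕ≡-/ℕ a = trans (solve₁ (+ (a %ℕ n)) (a /ℕ n) (+ n)) (cong (λ x → x - + n * (a /ℕ n)) (sym (a≡a%ℕn+[a/ℕn]*n a n)))
    where solve₁ : ∀ r k n → r ≡ r + k * n - n * k
          solve₁ = solve-∀

  /ℕ-shift : ∀ a k → (a + + n * k) /ℕ n ≡ a /ℕ n + k
  /ℕ-shift a k = /ℕ-unique (a + + n * k) (a /ℕ n + k) (a %ℕ n) (n%ℕd<d a n)
    (trans (cong (_+ + n * k) (a≡a%ℕn+[a/ℕn]*n a n)) (solve₁ (+ (a %ℕ n)) (a /ℕ n) k (+ n)))
    where solve₁ : ∀ r q k n → r + q * n + n * k ≡ r + (q + k) * n
          solve₁ = solve-∀

  %ℕ-shift : ∀ a k → (a + + n * k) %ℕ n ≡ a %ℕ n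
  %ℕ-shift a k = +-injective (begin
    + ((a + + n * k) %ℕ n)                    ≡⟨ %ℕ≡-/ℕ (a + + n * k) ⟩
    a + + n * k - + n * ((a + + n * k) /ℕ n)  ≡⟨ cong (λ x → a + + n * k - + n * x) (/ℕ-shift a k) ⟩
    a + + n * k - + n * (a /ℕ n + k)          ≡⟨ solve₁ a k (+ n) (a /ℕ n) ⟩
    a - + n * (a /ℕ n)                        ≡⟨ %ℕ≡-/ℕ a ⟨
    + (a %ℕ n)                                ∎)
    where
      open ≡-Reasoning
      solve₁ : ∀ a k n q → a + n * k - n * (q + k) ≡ a - n * q
      solve₁ = solve-∀

  box-unique : ∀ a b k → - b ≤ a + + n * k → a + + n * k < - b + + n → k ≡ - ((a + b) /ℕ n)
  box-unique a b k lower upper = trans (sym (neg-involutive k)) (cong -_ (sym (/ℕ-unique (a + b) (- k) ∣ R ∣ R<n a+b≡)))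
    where
      R = a + + n * k + b
      +∣R∣≡R : + ∣ R ∣ ≡ R
      +∣R∣≡R = 0≤i⇒+∣i∣≡i (≤-by-diff _ (i≤j⇒0≤j-i lower) (solve₁ a b (+ n * k)))
        where solve₁ : ∀ a b x → a + x - - b ≡ a + x + b - 0ℤ
              solve₁ = solve-∀
      R<n : ∣ R ∣ ℕ.< n
      R<n = drop‿+≤+ (≤-by-diff _ (i≤j⇒0≤j-i (i<j⇒suc[i]≤j upper))
              (trans (solve₂ a b (+ n * k) (+ n)) (cong (λ x → + n - (1ℤ + x)) (sym +∣R∣≡R))))
        where solve₂ : ∀ a b x n → - b + n - (1ℤ + (a + x)) ≡ n - (1ℤ + (a + x + b))
              solve₂ = solve-∀
      a+b≡ : a + b ≡ + ∣ R ∣ + - k * + n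
      a+b≡ = trans (solve₃ a b k (+ n)) (cong (_+ - k * + n) (sym +∣R∣≡R))
        where solve₃ : ∀ a b k n → a + b ≡ a + n * k + b + - k * n
              solve₃ = solve-∀

  box-witness : ∀ a b → let k = - ((a + b) /ℕ n) in - b ≤ a + + n * k × a + + n * k < - b + + n
  box-witness a b =
    ≤-by-diff (+ ((a + b) %ℕ n)) (+≤+ ℕ.z≤n) (trans (%ℕ≡-/ℕ (a + b)) (solve₁ a b (+ n) ((a + b) /ℕ n))) ,
    suc[i]≤j⇒i<j (≤-by-diff (+ n - (1ℤ + + ((a + b) %ℕ n))) (i≤j⇒0≤j-i (+≤+ (n%ℕd<d (a + b) n)))
      (trans (cong (λ x → + n - (1ℤ + x)) (%ℕ≡-/ℕ (a + b))) (solve₂ a b (+ n) ((a + b) /ℕ n))))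
    where
      solve₁ : ∀ a b n q → a + b - n * q ≡ a + n * - q - - b
      solve₁ = solve-∀
      solve₂ : ∀ a b n q → n - (1ℤ + (a + b - n * q)) ≡ - b + n - (1ℤ + (a + n * - q))
      solve₂ = solve-∀

  %ℕ-periodic : ∀ a → (a + + n) %ℕ n ≡ a %ℕ n
  %ℕ-periodic a = trans (cong (λ x → (a + x) %ℕ n) (sym (*-identityʳ (+ n)))) (%ℕ-shift a 1ℤ)

  ∑-%ℕ : ∀ w → ∑[ k < n ] ((w + + k) %ℕ n) ≡ ∑[ k < n ] k
  ∑-%ℕ w = trans (∑-periodic-shift n (_%ℕ n) %ℕ-periodic w) (∑-cong n (λ k k<n → m<n⇒m%n≡m k<n))

  ∑-%ℕ-reverse : ∀ w → ∑[ k < n ] ((w - + k) %ℕ n) ≡ ∑[ k < n ] k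
  ∑-%ℕ-reverse w = trans (∑-reverse n _) (trans (∑-cong n (λ k k<n → cong (_%ℕ n) (reflect k k<n))) (∑-%ℕ (w - + n + 1ℤ)))
    where
      reflect : ∀ k → k ℕ.< n → w - + (n ℕ.∸ suc k) ≡ w - + n + 1ℤ + + k
      reflect k k<n = trans (cong (λ x → w - x) (trans (sym (⊖-≥ k<n)) (sym (m-n≡m⊖n n (suc k))))) (solve₁ w (+ n) (+ k))
        where solve₁ : ∀ w n k → w - (n + - (1ℤ + k)) ≡ w - n + 1ℤ + k
              solve₁ = solve-∀

  quotients : ∀ {l} → Vec ℤ l → ℤ → ℤ
  quotients v a = sumℤ (map (λ z → (a + z) /ℕ n) v)

  remainders : ∀ {l} → Vec ℤ l → ℤ → ℕ
  remainders v a = sum (map (λ z → (a + z) %ℕ n) v)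

  remainders≡ : ∀ {l} (v : Vec ℤ l) a → + remainders v a ≡ + l * a + sumℤ v - + n * quotients v a
  remainders≡ []      a = solve₁ a (+ n)
    where solve₁ : ∀ a n → 0ℤ ≡ 0ℤ * a + 0ℤ - n * 0ℤ
          solve₁ = solve-∀
  remainders≡ {suc l} (z ∷ v) a = begin
    + ((a + z) %ℕ n ℕ.+ remainders v a)                                     ≡⟨ pos-+ ((a + z) %ℕ n) (remainders v a) ⟩
    + ((a + z) %ℕ n) + + remainders v a                                     ≡⟨ cong₂ _+_ (%ℕ≡-/ℕ (a + z)) (remainders≡ v a) ⟩
    a + z - + n * ((a + z) /ℕ n) + (+ l * a + sumℤ v - + n * quotients v a) ≡⟨ solve₁ a z (+ l) (sumℤ v) (+ n) ((a + z) /ℕ n) (quotients v a) ⟩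
    (1ℤ + + l) * a + (z + sumℤ v) - + n * ((a + z) /ℕ n + quotients v a)    ∎
    where
      open ≡-Reasoning
      solve₁ : ∀ a z l S n q Q → a + z - n * q + (l * a + S - n * Q) ≡ (1ℤ + l) * a + (z + S) - n * (q + Q)
      solve₁ = solve-∀

  quotients-shift : ∀ {l} (v : Vec ℤ l) a k → quotients v (a + + n * k) ≡ quotients v a + + l * k
  quotients-shift []      a k = sym (*-zeroˡ k)
  quotients-shift {suc l} (z ∷ v) a k = begin
    (a + + n * k + z) /ℕ n + quotients v (a + + n * k)    ≡⟨ cong₂ _+_ (trans (cong (_/ℕ n) (solve₁ a (+ n * k) z)) (/ℕ-shift (a + z) k)) (quotients-shift v a k) ⟩
    ((a + z) /ℕ n + k) + (quotients v a + + l * k)        ≡⟨ solve₂ ((a + z) /ℕ n) k (quotients v a) (+ l) ⟩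
    ((a + z) /ℕ n + quotients v a) + (1ℤ + + l) * k       ∎
    where
      open ≡-Reasoning
      solve₁ : ∀ a x z → a + x + z ≡ a + z + x
      solve₁ = solve-∀
      solve₂ : ∀ q k Q l → (q + k) + (Q + l * k) ≡ (q + Q) + (1ℤ + l) * k
      solve₂ = solve-∀

  remainders-shift : ∀ {l} (v : Vec ℤ l) a k → remainders v (a + + n * k) ≡ remainders v a
  remainders-shift []      a k = refl
  remainders-shift (z ∷ v) a k =
    cong₂ ℕ._+_ (trans (cong (_%ℕ n) (solve₁ a (+ n * k) z)) (%ℕ-shift (a + z) k)) (remainders-shift v a k)
    where solve₁ : ∀ a x z → a + x + z ≡ a + z + x
          solve₁ = solve-∀

  remainders-≤ : ∀ {l} (v : Vec ℤ l) a → remainders v a ℕ.≤ l ℕ.* n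
  remainders-≤ []      a = ℕ.z≤n
  remainders-≤ (z ∷ v) a = ℕ.+-mono-≤ (ℕ.<⇒≤ (n%ℕd<d (a + z) n)) (remainders-≤ v a)

∑-sum-map : ∀ m {l} (f : ℕ → ℤ → ℕ) c (v : Vec ℤ l) → (∀ z → ∑[ k < m ] f k z ≡ c) →
  ∑[ k < m ] sum (map (f k) v) ≡ l ℕ.* c
∑-sum-map m f c []      ∑f≡c = ∑-zero m (λ _ _ → refl)
∑-sum-map m f c (z ∷ v) ∑f≡c =
  trans (∑-distrib-+ m (λ k → f k z) (λ k → sum (map (f k) v))) (cong₂ ℕ._+_ (∑f≡c z) (∑-sum-map m f c v ∑f≡c))

sumℤ-neg : ∀ {l} (f : ℤ → ℤ) (v : Vec ℤ l) → sumℤ (map (λ z → - f z) v) ≡ - sumℤ (map f v)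
sumℤ-neg f []      = refl
sumℤ-neg f (z ∷ v) = trans (cong (λ a → - f z + a) (sumℤ-neg f v)) (sym (neg-distrib-+ (f z) (sumℤ (map f v))))

lookup-ext : ∀ {A : Set} {l} (v w : Vec A l) → (∀ μ → lookup v μ ≡ lookup w μ) → v ≡ w
lookup-ext v w v≐w = trans (sym (tabulate∘lookup v)) (trans (tabulate-cong v≐w) (tabulate∘lookup w))

module Lattice (p : ℕ) (s t : Vec ℤ p) (u : ℤ) where

  q n₂ : ℕ
  q  = suc p
  n₂ = q ℕ.* q ℕ.+ q

  -- Q, Q1 and Q2 are spelled as in Ω, and Q2 is definitionally + n₂.
  P Q Q1 Q2 : ℤ
  P  = + p
  Q  = + q
  Q1 = Q + + 1
  Q2 = Q * Q + Q

  σ C : ℤ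
  σ = sumℤ s + sumℤ t
  C = u + σ

  Ks Kt : ℤ → ℤ
  Ks = quotients n₂ s
  Kt = quotients n₂ t

  -- kVec i and jVec i are the only k and j meeting the μ- and ν-conditions, and
  -- x i = Q i - Q1 Σ (kVec i) is the part of the ν-forms that does not involve j.
  x : ℤ → ℤ
  x i = Q * i + Q1 * Ks i

  kVec : ℤ → Vec ℤ p
  kVec i = map (λ z → - ((i + z) /ℕ n₂)) s

  jVec : ℤ → Vec ℤ p
  jVec i = map (λ z → - ((x i + z) /ℕ n₂)) t

  d : ℤ → ℕ
  d i = remainders n₂ s i ℕ.+ remainders n₂ t (x i)

  point : ℤ → Point q
  point i = i , jVec i , kVec i

  f-formula : ∀ i → i + + d i ≡ σ + Q2 * (i - Kt (x i)) - x i
  f-formula i = begin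
    i + + d i                                                                 ≡⟨ cong (λ a → i + a) (pos-+ (remainders n₂ s i) (remainders n₂ t (x i))) ⟩
    i + (+ remainders n₂ s i + + remainders n₂ t (x i))                       ≡⟨ cong (λ a → i + a) (cong₂ _+_ (remainders≡ n₂ s i) (remainders≡ n₂ t (x i))) ⟩
    i + (P * i + sumℤ s - Q2 * Ks i + (P * x i + sumℤ t - Q2 * Kt (x i)))    ≡⟨ solve₁ P i (sumℤ s) (sumℤ t) (Ks i) (Kt (x i)) ⟩
    σ + Q2 * (i - Kt (x i)) - x i                                             ∎
    where
      open ≡-Reasoning
      solve₁ : ∀ P i Σs Σt K K′ →
        i + (P * i + Σs - ((1ℤ + P) * (1ℤ + P) + (1ℤ + P)) * K
             + (P * ((1ℤ + P) * i + ((1ℤ + P) + + 1) * K) + Σt - ((1ℤ + P) * (1ℤ + P) + (1ℤ + P)) * K′))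
        ≡ (Σs + Σt) + ((1ℤ + P) * (1ℤ + P) + (1ℤ + P)) * (i - K′) - ((1ℤ + P) * i + ((1ℤ + P) + + 1) * K)
      solve₁ = solve-∀

  last-form : ∀ i → - (Q * Q) * i - Q2 * sumℤ (jVec i) - Q1 * sumℤ (kVec i) ≡ σ - (i + + d i)
  last-form i = begin
    - (Q * Q) * i - Q2 * sumℤ (jVec i) - Q1 * sumℤ (kVec i)
      ≡⟨ cong₂ (λ a b → - (Q * Q) * i - Q2 * a - Q1 * b) (sumℤ-neg (λ z → (x i + z) /ℕ n₂) t) (sumℤ-neg (λ z → (i + z) /ℕ n₂) s) ⟩
    - (Q * Q) * i - Q2 * - Kt (x i) - Q1 * - Ks i
      ≡⟨ solve₁ Q i σ (Ks i) (Kt (x i)) ⟩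
    σ - (σ + Q2 * (i - Kt (x i)) - x i)
      ≡⟨ cong (λ a → σ - a) (f-formula i) ⟨
    σ - (i + + d i) ∎
    where
      open ≡-Reasoning
      solve₁ : ∀ Q i σ K K′ → - (Q * Q) * i - (Q * Q + Q) * - K′ - (Q + + 1) * - K
                              ≡ σ - (σ + (Q * Q + Q) * (i - K′) - (Q * i + (Q + + 1) * K))
      solve₁ = solve-∀

  ν-form : ∀ i j → Q * i + Q2 * j - Q1 * sumℤ (kVec i) ≡ x i + Q2 * j
  ν-form i j = trans (cong (λ a → Q * i + Q2 * j - Q1 * a) (sumℤ-neg (λ z → (i + z) /ℕ n₂) s)) (solve₁ Q i j (Ks i))
    where solve₁ : ∀ Q i j K → Q * i + (Q * Q + Q) * j - (Q + + 1) * - K ≡ Q * i + (Q + + 1) * K + (Q * Q + Q) * j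
          solve₁ = solve-∀

  last-≤ : ∀ i → - u ≤ σ - (i + + d i) → i + + d i ≤ C
  last-≤ i h = ≤-by-diff _ (i≤j⇒0≤j-i h) (solve₁ u σ (i + + d i))
    where solve₁ : ∀ u σ f → σ - f - - u ≡ u + σ - f
          solve₁ = solve-∀

  ≤-last : ∀ i → i + + d i ≤ C → - u ≤ σ - (i + + d i)
  ≤-last i h = ≤-by-diff _ (i≤j⇒0≤j-i h) (solve₁ u σ (i + + d i))
    where solve₁ : ∀ u σ f → u + σ - f ≡ σ - f - - u
          solve₁ = solve-∀

  point∈Ω : ∀ r i → - r ≤ i × i + + d i ≤ C → Ω q r s t u (point i)
  point∈Ω r i (-r≤i , fi≤C) = -r≤i , μ-box , ν-box , subst (- u ≤_) (sym (last-form i)) (≤-last i fi≤C)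
    where
      μ-box : ∀ μ → (- lookup s μ ≤ i + Q2 * lookup (kVec i) μ) × (i + Q2 * lookup (kVec i) μ < - lookup s μ + Q2)
      μ-box μ rewrite lookup-map μ (λ z → - ((i + z) /ℕ n₂)) s = box-witness n₂ i (lookup s μ)
      ν-box : ∀ ν → (- lookup t ν ≤ Q * i + Q2 * lookup (jVec i) ν - Q1 * sumℤ (kVec i))
                  × (Q * i + Q2 * lookup (jVec i) ν - Q1 * sumℤ (kVec i) < - lookup t ν + Q2)
      ν-box ν rewrite ν-form i (lookup (jVec i) ν) | lookup-map ν (λ z → - ((x i + z) /ℕ n₂)) t = box-witness n₂ (x i) (lookup t ν)

  Ω⇒point : ∀ r y → Ω q r s t u y → Σ ℤ λ i → (- r ≤ i × i + + d i ≤ C) × y ≡ point i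
  Ω⇒point r (i , j , k) (-r≤i , μ-box , ν-box , last) = i , (-r≤i , last-≤ i last′) , cong₂ (λ j k → i , j , k) j≡ k≡
    where
      k≡ : k ≡ kVec i
      k≡ = lookup-ext k (kVec i) λ μ →
        trans (box-unique n₂ i (lookup s μ) (lookup k μ) (proj₁ (μ-box μ)) (proj₂ (μ-box μ)))
              (sym (lookup-map μ (λ z → - ((i + z) /ℕ n₂)) s))
      ν-form′ : ∀ ν → Q * i + Q2 * lookup j ν - Q1 * sumℤ k ≡ x i + Q2 * lookup j ν
      ν-form′ ν rewrite k≡ = ν-form i (lookup j ν)
      j≡ : j ≡ jVec i
      j≡ = lookup-ext j (jVec i) λ ν →
        trans (box-unique n₂ (x i) (lookup t ν) (lookup j ν)
                (subst (- lookup t ν ≤_) (ν-form′ ν) (proj₁ (ν-box ν)))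
                (subst (_< - lookup t ν + Q2) (ν-form′ ν) (proj₂ (ν-box ν))))
              (sym (lookup-map ν (λ z → - ((x i + z) /ℕ n₂)) t))
      last′ : - u ≤ σ - (i + + d i)
      last′ = subst (- u ≤_) (trans (cong₂ (λ j k → - (Q * Q) * i - Q2 * sumℤ j - Q1 * sumℤ k) j≡ k≡) (last-form i)) last

  x-shift : ∀ i m → x (i + Q2 * m) ≡ x i + Q2 * (Q1 * m) - Q1 * m
  x-shift i m = begin
    Q * (i + Q2 * m) + Q1 * Ks (i + Q2 * m)  ≡⟨ cong (λ a → Q * (i + Q2 * m) + Q1 * a) (quotients-shift n₂ s i m) ⟩
    Q * (i + Q2 * m) + Q1 * (Ks i + P * m)   ≡⟨ solve₁ P i m (Ks i) ⟩
    x i + Q2 * (Q1 * m) - Q1 * m             ∎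
    where
      open ≡-Reasoning
      solve₁ : ∀ P i m K →
        (1ℤ + P) * (i + ((1ℤ + P) * (1ℤ + P) + (1ℤ + P)) * m) + ((1ℤ + P) + + 1) * (K + P * m)
        ≡ (1ℤ + P) * i + ((1ℤ + P) + + 1) * K + ((1ℤ + P) * (1ℤ + P) + (1ℤ + P)) * (((1ℤ + P) + + 1) * m) - ((1ℤ + P) + + 1) * m
      solve₁ = solve-∀

  D : ℕ
  D = p ℕ.* n₂ ℕ.+ p ℕ.* n₂

  d-≤ : ∀ i → d i ℕ.≤ D
  d-≤ i = ℕ.+-mono-≤ (remainders-≤ n₂ s i) (remainders-≤ n₂ t (x i))

  d-periodic : ∀ i → d (i + + (q ℕ.* n₂)) ≡ d i
  d-periodic i rewrite pos-* q n₂ | *-comm Q Q2 =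
    cong₂ ℕ._+_ (remainders-shift n₂ s i Q)
      (trans (cong (remainders n₂ t) (trans (x-shift i Q) (solve₁ Q (x i))))
             (remainders-shift n₂ t (x i) (Q1 * Q - 1ℤ)))
    where solve₁ : ∀ Q x → x + (Q * Q + Q) * ((Q + + 1) * Q) - (Q + + 1) * Q ≡ x + (Q * Q + Q) * ((Q + + 1) * Q - 1ℤ)
          solve₁ = solve-∀

  -- Writing x i = - β + Q2 * Z turns  f i ≡ σ + β  into  i ≡ Kt (- β) + Q * Z; the witness below
  -- solves this pair of conditions, using that Ks only shifts by p * m along i ↦ i + Q2 * m.
  f-surjective : ∀ b → Σ ℤ λ i → i + + d i ≡ b
  f-surjective b = i , (begin
    i + + d i                                        ≡⟨ f-formula i ⟩
    σ + Q2 * (i - Kt (x i)) - x i                    ≡⟨ cong₂ (λ a y → σ + Q2 * (i - a) - y) Kt-x≡ x≡ ⟩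
    σ + Q2 * (i - (Kt (- β) + P * Z)) - (- β + Q2 * Z) ≡⟨ solve₂ P b σ (Ks ρ) (Kt (- β)) ⟩
    b                                                ∎)
    where
      open ≡-Reasoning
      β = b - σ
      w = β - Kt (- β)
      ρ = β - Q1 * w
      m = β + Ks ρ
      i = ρ + Q2 * m
      Z = Q1 * m - w
      x≡ : x i ≡ - β + Q2 * Z
      x≡ = begin
        Q * i + Q1 * Ks i              ≡⟨ cong (λ a → Q * i + Q1 * a) (quotients-shift n₂ s ρ m) ⟩
        Q * i + Q1 * (Ks ρ + P * m)    ≡⟨ solve₁ P b σ (Ks ρ) (Kt (- β)) ⟩
        - β + Q2 * Z                   ∎
        where
          solve₁ : ∀ P b σ K K′ →
            (1ℤ + P) * ((b - σ - ((1ℤ + P) + + 1) * (b - σ - K′)) + ((1ℤ + P) * (1ℤ + P) + (1ℤ + P)) * (b - σ + K))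
              + ((1ℤ + P) + + 1) * (K + P * (b - σ + K))
            ≡ - (b - σ) + ((1ℤ + P) * (1ℤ + P) + (1ℤ + P)) * (((1ℤ + P) + + 1) * (b - σ + K) - (b - σ - K′))
          solve₁ = solve-∀
      Kt-x≡ : Kt (x i) ≡ Kt (- β) + P * Z
      Kt-x≡ = trans (cong Kt x≡) (quotients-shift n₂ t (- β) Z)
      solve₂ : ∀ P b σ K K′ →
        σ + ((1ℤ + P) * (1ℤ + P) + (1ℤ + P))
              * (((b - σ - ((1ℤ + P) + + 1) * (b - σ - K′)) + ((1ℤ + P) * (1ℤ + P) + (1ℤ + P)) * (b - σ + K))
                 - (K′ + P * (((1ℤ + P) + + 1) * (b - σ + K) - (b - σ - K′))))
          - (- (b - σ) + ((1ℤ + P) * (1ℤ + P) + (1ℤ + P)) * (((1ℤ + P) + + 1) * (b - σ + K) - (b - σ - K′)))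
        ≡ b
      solve₂ = solve-∀

  f-equal⇒shifted : ∀ i i′ → i + + d i ≡ i′ + + d i′ → Σ ℤ λ δ → i′ ≡ i + Q * δ × x i′ ≡ x i + Q2 * δ
  f-equal⇒shifted i i′ fi≡fi′ = δ , i′≡i+Qδ , x′≡
    where
      open ≡-Reasoning
      δ = (i′ - Kt (x i′)) - (i - Kt (x i))
      x′≡ : x i′ ≡ x i + Q2 * δ
      x′≡ = begin
        x i′                                                          ≡⟨ solve₂ σ Q2 i i′ (Kt (x i)) (Kt (x i′)) (x i) (x i′) ⟩
        x i + Q2 * δ + ((σ + Q2 * (i - Kt (x i)) - x i) - (σ + Q2 * (i′ - Kt (x i′)) - x i′))
          ≡⟨ cong (λ a → x i + Q2 * δ + a) (i≡j⇒i-j≡0 (trans (sym (f-formula i)) (trans fi≡fi′ (f-formula i′)))) ⟩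
        x i + Q2 * δ + 0ℤ                                             ≡⟨ +-identityʳ _ ⟩
        x i + Q2 * δ                                                  ∎
        where solve₂ : ∀ σ N i i′ K K′ y y′ → y′ ≡ y + N * ((i′ - K′) - (i - K)) + ((σ + N * (i - K) - y) - (σ + N * (i′ - K′) - y′))
              solve₂ = solve-∀
      i′≡i+Qδ : i′ ≡ i + Q * δ
      i′≡i+Qδ = begin
        i′                                          ≡⟨ solve₂ i i′ (Kt (x i)) (Kt (x i′)) ⟩
        i + δ + (Kt (x i′) - Kt (x i))              ≡⟨ cong (λ a → i + δ + (a - Kt (x i))) (trans (cong Kt x′≡) (quotients-shift n₂ t (x i) δ)) ⟩
        i + δ + ((Kt (x i) + P * δ) - Kt (x i))     ≡⟨ solve₃ P i (Kt (x i)) δ ⟩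
        i + Q * δ                                   ∎
        where solve₂ : ∀ i i′ K K′ → i′ ≡ i + ((i′ - K′) - (i - K)) + (K′ - K)
              solve₂ = solve-∀
              solve₃ : ∀ P i K δ → i + δ + ((K + P * δ) - K) ≡ i + (1ℤ + P) * δ
              solve₃ = solve-∀

  -- Q1 * (Ks i′ - Ks i) ≡ Q * δ forces δ = Q1 * Y and i′ = i + Q2 * Y, and then Ks i′ - Ks i is both Q * Y and P * Y.
  shifted⇒equal : ∀ i i′ δ → i′ ≡ i + Q * δ → x i′ ≡ x i + Q2 * δ → i′ ≡ i
  shifted⇒equal i i′ δ i′≡i+Qδ x′≡ = trans i′≡i+Q2Y (trans (cong (λ a → i + Q2 * a) Y≡0) (solve₁ Q2 i))
    where
      open ≡-Reasoning
      X = Ks i′ - Ks i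
      Y = δ - X
      solve₁ : ∀ N i → i + N * 0ℤ ≡ i
      solve₁ = solve-∀
      Q1X≡Qδ : Q1 * X ≡ Q * δ
      Q1X≡Qδ = begin
        Q1 * X                                       ≡⟨ solve₂ Q i i′ (Ks i) (Ks i′) ⟩
        x i′ - x i - Q * (i′ - i)                    ≡⟨ cong₂ (λ a b → a - x i - Q * (b - i)) x′≡ i′≡i+Qδ ⟩
        x i + Q2 * δ - x i - Q * (i + Q * δ - i)     ≡⟨ solve₃ Q (x i) i δ ⟩
        Q * δ                                        ∎
        where solve₂ : ∀ Q i i′ K K′ → (Q + + 1) * (K′ - K) ≡ (Q * i′ + (Q + + 1) * K′) - (Q * i + (Q + + 1) * K) - Q * (i′ - i)
              solve₂ = solve-∀
              solve₃ : ∀ Q y i δ → y + (Q * Q + Q) * δ - y - Q * (i + Q * δ - i) ≡ Q * δ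
              solve₃ = solve-∀
      X≡QY : X ≡ Q * Y
      X≡QY = trans (solve₂ Q X) (trans (cong (λ a → a - Q * X) Q1X≡Qδ) (solve₃ Q δ X))
        where solve₂ : ∀ Q X → X ≡ (Q + + 1) * X - Q * X
              solve₂ = solve-∀
              solve₃ : ∀ Q δ X → Q * δ - Q * X ≡ Q * (δ - X)
              solve₃ = solve-∀
      i′≡i+Q2Y : i′ ≡ i + Q2 * Y
      i′≡i+Q2Y = trans i′≡i+Qδ (trans (solve₂ Q i δ X) (trans (cong (λ a → i + Q * (a + Y)) X≡QY) (solve₃ Q i Y)))
        where solve₂ : ∀ Q i δ X → i + Q * δ ≡ i + Q * (X + (δ - X))
              solve₂ = solve-∀
              solve₃ : ∀ Q i Y → i + Q * (Q * Y + Y) ≡ i + (Q * Q + Q) * Y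
              solve₃ = solve-∀
      X≡PY : X ≡ P * Y
      X≡PY = trans (cong (λ a → Ks a - Ks i) i′≡i+Q2Y) (trans (cong (_- Ks i) (quotients-shift n₂ s i Y)) (solve₂ (Ks i) (P * Y)))
        where solve₂ : ∀ a b → (a + b) - a ≡ b
              solve₂ = solve-∀
      Y≡0 : Y ≡ 0ℤ
      Y≡0 = trans (solve₂ P Y) (trans (cong₂ _-_ (sym X≡QY) (sym X≡PY)) (+-inverseʳ X))
        where solve₂ : ∀ P Y → Y ≡ (1ℤ + P) * Y - P * Y
              solve₂ = solve-∀

  f-injective : ∀ i i′ → i + + d i ≡ i′ + + d i′ → i ≡ i′
  f-injective i i′ fi≡fi′ = let δ , i′≡i+Qδ , x′≡ = f-equal⇒shifted i i′ fi≡fi′ in sym (shifted⇒equal i i′ δ i′≡i+Qδ x′≡)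

  Q1ℕ : ℕ
  Q1ℕ = q ℕ.+ 1

  n₂≡q*Q1 : n₂ ≡ q ℕ.* Q1ℕ
  n₂≡q*Q1 = ℕ-solve₁ q
    where ℕ-solve₁ : ∀ q → q ℕ.* q ℕ.+ q ≡ q ℕ.* (q ℕ.+ 1)
          ℕ-solve₁ = ℕ-solve-∀

  ∑-μ-remainder : ∀ z → ∑[ k < q ℕ.* n₂ ] ((+ k + z) %ℕ n₂) ≡ q ℕ.* ∑[ k < n₂ ] k
  ∑-μ-remainder z = trans (∑-periodic-* n₂ (λ a → (a + z) %ℕ n₂) periodic q)
                          (cong (q ℕ.*_) (trans (∑-cong n₂ (λ k _ → cong (_%ℕ n₂) (+-comm (+ k) z))) (∑-%ℕ n₂ z)))
    where periodic : ∀ a → (a + + n₂ + z) %ℕ n₂ ≡ (a + z) %ℕ n₂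
          periodic a = trans (cong (_%ℕ n₂) (solve₁ a (+ n₂) z)) (%ℕ-periodic n₂ (a + z))
            where solve₁ : ∀ a n z → a + n + z ≡ a + z + n
                  solve₁ = solve-∀

  ψ : ℤ → ℕ
  ψ y = ∑[ b < q ] ((y - Q1 * + b) %ℕ n₂)

  ψ-periodic : ∀ y m → ψ (y + Q1 * m) ≡ ψ y
  ψ-periodic y m = trans (step⇒constant (λ m → ψ (y + Q1 * m)) step m) (cong ψ (solve₁ Q1 y))
    where
      solve₁ : ∀ N y → y + N * 0ℤ ≡ y
      solve₁ = solve-∀
      step : ∀ m → ψ (y + Q1 * (m + 1ℤ)) ≡ ψ (y + Q1 * m)
      step m = trans (∑-cong q (λ b _ → cong (_%ℕ n₂) (solve₂ Q y m (+ b))))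
                     (∑-periodic-shift q (λ c → (y + Q1 * m - Q1 * c) %ℕ n₂) θ-periodic -1ℤ)
        where
          solve₂ : ∀ Q y m b → y + (Q + + 1) * (m + 1ℤ) - (Q + + 1) * b ≡ y + (Q + + 1) * m - (Q + + 1) * (-1ℤ + b)
          solve₂ = solve-∀
          θ-periodic : ∀ c → (y + Q1 * m - Q1 * (c + Q)) %ℕ n₂ ≡ (y + Q1 * m - Q1 * c) %ℕ n₂
          θ-periodic c = trans (cong (_%ℕ n₂) (solve₃ Q (y + Q1 * m) c)) (%ℕ-shift n₂ (y + Q1 * m - Q1 * c) -1ℤ)
            where solve₃ : ∀ Q a c → a - (Q + + 1) * (c + Q) ≡ a - (Q + + 1) * c + (Q * Q + Q) * -1ℤ
                  solve₃ = solve-∀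

  ∑-ψ : ∀ z → ∑[ j < Q1ℕ ] ψ (z - + j) ≡ ∑[ k < n₂ ] k
  ∑-ψ z = begin
    ∑[ j < Q1ℕ ] ∑[ b < q ] ((z - + j - Q1 * + b) %ℕ n₂)             ≡⟨ ∑-comm Q1ℕ q _ ⟩
    ∑[ b < q ] ∑[ j < Q1ℕ ] ((z - + j - Q1 * + b) %ℕ n₂)             ≡⟨ ∑-cong q (λ b _ → ∑-cong Q1ℕ (λ j _ → cong (_%ℕ n₂) (flatten b j))) ⟩
    ∑[ b < q ] ∑[ j < Q1ℕ ] ((z - + (b ℕ.* Q1ℕ ℕ.+ j)) %ℕ n₂)        ≡⟨ ∑-* q Q1ℕ (λ k → (z - + k) %ℕ n₂) ⟨
    ∑[ k < q ℕ.* Q1ℕ ] ((z - + k) %ℕ n₂)                            ≡⟨ cong (λ n → ∑[ k < n ] ((z - + k) %ℕ n₂)) n₂≡q*Q1 ⟨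
    ∑[ k < n₂ ] ((z - + k) %ℕ n₂)                                   ≡⟨ ∑-%ℕ-reverse n₂ z ⟩
    ∑[ k < n₂ ] k                                                   ∎
    where
      open ≡-Reasoning
      flatten : ∀ b j → z - + j - Q1 * + b ≡ z - + (b ℕ.* Q1ℕ ℕ.+ j)
      flatten b j = trans (solve₁ z (+ j) Q1 (+ b)) (cong (λ a → z - a) (sym (trans (pos-+ (b ℕ.* Q1ℕ) j) (cong (_+ + j) (pos-* b Q1ℕ)))))
        where solve₁ : ∀ z j N b → z - j - N * b ≡ z - (b * N + j)
              solve₁ = solve-∀

  -- Shifting i by Q2 * b lowers x i + z by Q1 * b modulo Q2, and x i ≡ - i modulo Q1;
  -- so over a period x i + z runs through every residue modulo Q2 equally often.
  ∑-ν-remainder : ∀ z → ∑[ k < q ℕ.* n₂ ] ((x (+ k) + z) %ℕ n₂) ≡ q ℕ.* ∑[ k < n₂ ] k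
  ∑-ν-remainder z = begin
    ∑[ k < q ℕ.* n₂ ] ((x (+ k) + z) %ℕ n₂)                            ≡⟨ ∑-* q n₂ _ ⟩
    ∑[ b < q ] ∑[ j < n₂ ] ((x (+ (b ℕ.* n₂ ℕ.+ j)) + z) %ℕ n₂)       ≡⟨ ∑-comm q n₂ _ ⟩
    ∑[ j < n₂ ] ∑[ b < q ] ((x (+ (b ℕ.* n₂ ℕ.+ j)) + z) %ℕ n₂)       ≡⟨ ∑-cong n₂ (λ j _ → ∑-cong q (λ b _ → block j b)) ⟩
    ∑[ j < n₂ ] ψ (x (+ j) + z)                                       ≡⟨ ∑-cong n₂ (λ j _ → trans (cong ψ (unwind j)) (ψ-periodic (z - + j) _)) ⟩
    ∑[ j < n₂ ] ψ (z - + j)                                           ≡⟨ cong (λ n → ∑[ j < n ] ψ (z - + j)) n₂≡q*Q1 ⟩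
    ∑[ j < q ℕ.* Q1ℕ ] ψ (z - + j)                                    ≡⟨ ∑-periodic-* Q1ℕ (λ a → ψ (z - a)) ψ-reflected-periodic q ⟩
    q ℕ.* ∑[ j < Q1ℕ ] ψ (z - + j)                                    ≡⟨ cong (q ℕ.*_) (∑-ψ z) ⟩
    q ℕ.* ∑[ k < n₂ ] k                                               ∎
    where
      open ≡-Reasoning
      block : ∀ j b → (x (+ (b ℕ.* n₂ ℕ.+ j)) + z) %ℕ n₂ ≡ (x (+ j) + z - Q1 * + b) %ℕ n₂
      block j b = begin
        (x (+ (b ℕ.* n₂ ℕ.+ j)) + z) %ℕ n₂                     ≡⟨ cong (λ a → (x a + z) %ℕ n₂) (trans (pos-+ (b ℕ.* n₂) j) (trans (cong (_+ + j) (pos-* b n₂)) (solve₁ (+ b) Q2 (+ j)))) ⟩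
        (x (+ j + Q2 * + b) + z) %ℕ n₂                          ≡⟨ cong (λ a → (a + z) %ℕ n₂) (x-shift (+ j) (+ b)) ⟩
        (x (+ j) + Q2 * (Q1 * + b) - Q1 * + b + z) %ℕ n₂        ≡⟨ cong (_%ℕ n₂) (solve₂ (x (+ j)) Q2 (Q1 * + b) z) ⟩
        (x (+ j) + z - Q1 * + b + Q2 * (Q1 * + b)) %ℕ n₂        ≡⟨ %ℕ-shift n₂ (x (+ j) + z - Q1 * + b) (Q1 * + b) ⟩
        (x (+ j) + z - Q1 * + b) %ℕ n₂                          ∎
        where solve₁ : ∀ b N j → b * N + j ≡ j + N * b
              solve₁ = solve-∀
              solve₂ : ∀ y N c z → y + N * c - c + z ≡ y + z - c + N * c
              solve₂ = solve-∀
      unwind : ∀ j → x (+ j) + z ≡ z - + j + Q1 * (+ j + Ks (+ j))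
      unwind j = solve₁ Q (+ j) (Ks (+ j)) z
        where solve₁ : ∀ Q j K z → Q * j + (Q + + 1) * K + z ≡ z - j + (Q + + 1) * (j + K)
              solve₁ = solve-∀
      ψ-reflected-periodic : ∀ a → ψ (z - (a + + Q1ℕ)) ≡ ψ (z - a)
      ψ-reflected-periodic a = trans (cong ψ (solve₁ z a Q1)) (ψ-periodic (z - a) -1ℤ)
        where solve₁ : ∀ z a N → z - (a + N) ≡ z - a + N * -1ℤ
              solve₁ = solve-∀

  -- the mean of d: 2 (q - 1) remainders modulo Q2, each of mean (Q2 - 1) / 2
  g : ℕ
  g = p ℕ.* (q ℕ.* q ℕ.+ p)

  g3≡g : g3 q ≡ + g
  g3≡g = begin
    g3 q                               ≡⟨ solve₁ P ⟩
    P * (Q * Q + P)                    ≡⟨ cong (λ a → P * (a + P)) (pos-* q q) ⟨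
    P * (+ (q ℕ.* q) + P)              ≡⟨ cong (P *_) (pos-+ (q ℕ.* q) p) ⟨
    P * + (q ℕ.* q ℕ.+ p)              ≡⟨ pos-* p _ ⟨
    + g                                ∎
    where
      open ≡-Reasoning
      solve₁ : ∀ P → (1ℤ + P) * (1ℤ + P) * (1ℤ + P) - + 2 * (1ℤ + P) + + 1 ≡ P * ((1ℤ + P) * (1ℤ + P) + P)
      solve₁ = solve-∀

  ∑-d : ∑[ k < q ℕ.* n₂ ] d (+ k) ≡ q ℕ.* n₂ ℕ.* g
  ∑-d = begin
    ∑[ k < q ℕ.* n₂ ] d (+ k)                                   ≡⟨ ∑-distrib-+ (q ℕ.* n₂) _ _ ⟩
    ∑[ k < q ℕ.* n₂ ] remainders n₂ s (+ k) ℕ.+ ∑[ k < q ℕ.* n₂ ] remainders n₂ t (x (+ k))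
      ≡⟨ cong₂ ℕ._+_ (∑-sum-map (q ℕ.* n₂) (λ k z → (+ k + z) %ℕ n₂) _ s ∑-μ-remainder)
                     (∑-sum-map (q ℕ.* n₂) (λ k z → (x (+ k) + z) %ℕ n₂) _ t ∑-ν-remainder) ⟩
    p ℕ.* (q ℕ.* T) ℕ.+ p ℕ.* (q ℕ.* T)                          ≡⟨ ℕ-solve₁ p q T ⟩
    p ℕ.* q ℕ.* (2 ℕ.* T)                                        ≡⟨ cong (p ℕ.* q ℕ.*_) 2T≡ ⟩
    p ℕ.* q ℕ.* (n₂ ℕ.* (q ℕ.* q ℕ.+ p))                         ≡⟨ ℕ-solve₂ p q n₂ ⟩
    q ℕ.* n₂ ℕ.* g                                               ∎
    where
      open ≡-Reasoning
      T = ∑[ k < n₂ ] k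
      2T≡ : 2 ℕ.* T ≡ n₂ ℕ.* (q ℕ.* q ℕ.+ p)
      2T≡ = subst (λ n → 2 ℕ.* ∑[ k < n ] k ≡ n ℕ.* (q ℕ.* q ℕ.+ p)) (sym (ℕ.+-suc (q ℕ.* q) p)) (gauss (q ℕ.* q ℕ.+ p))
      ℕ-solve₁ : ∀ p q T → p ℕ.* (q ℕ.* T) ℕ.+ p ℕ.* (q ℕ.* T) ≡ p ℕ.* q ℕ.* (2 ℕ.* T)
      ℕ-solve₁ = ℕ-solve-∀
      ℕ-solve₂ : ∀ p q n → p ℕ.* q ℕ.* (n ℕ.* (q ℕ.* q ℕ.+ p)) ≡ q ℕ.* n ℕ.* (p ℕ.* (q ℕ.* q ℕ.+ p))
      ℕ-solve₂ = ℕ-solve-∀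

prime-power-nonZero : ∀ {q} → IsPrimePower q → NonZero q
prime-power-nonZero (a , m , a-prime , _ , q≡aᵐ) = subst NonZero (sym q≡aᵐ) (ℕ.m^n≢0 a m {{prime⇒nonZero a-prime}})

proposition3p1 : (q : ℕ) → IsPrimePower q → (s t : Vec ℤ (q ∸ 1)) → (u : ℤ) →
    Σ ℤ λ R → (r : ℤ) → R ≤ r →
      Σ ℕ λ N → HasCard (Ω q r s t u) N ×
        + N ≡ + 1 - g3 q + r + sumℤ s + sumℤ t + u
proposition3p1 zero    0-prime-power = ⊥-elim (ℕ.≢-nonZero⁻¹ 0 {{prime-power-nonZero 0-prime-power}} refl)
proposition3p1 (suc p) _ s t u = + D - (C + 1ℤ) , λ r R≤r →
  let N , card , N+g≡ = window (- r) C (≤-by-diff _ (i≤j⇒0≤j-i R≤r) (solve₁ r C (+ D))) in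
  N , hasCard-image point (cong proj₁) (point∈Ω r) (Ω⇒point r) card ,
  trans (solve₂ (+ N) (+ g)) (trans (cong₂ _-_ N+g≡ (sym g3≡g)) (solve₃ r u (sumℤ s) (sumℤ t) (g3 (suc p))))
  where
    open Lattice p s t u
    open Counting d D (q ℕ.* n₂) g d-≤ d-periodic f-surjective f-injective ∑-d
    solve₁ : ∀ r C D → r - (D - (C + 1ℤ)) ≡ C + 1ℤ - - r - D
    solve₁ = solve-∀
    solve₂ : ∀ N g → N ≡ N + g - g
    solve₂ = solve-∀
    solve₃ : ∀ r u a b G → u + (a + b) + 1ℤ - - r - G ≡ + 1 - G + r + a + b + u
    solve₃ = solve-∀
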